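{- Let $k\ge 3$ and let $G$ be a girth-regular graph of order $n$, valency $k$, even girth $g=2h$ and signature $\mathbf{a}=(a_1,a_2,\ldots,a_k)$. Then $$n\ge 2\frac{(k-1)^h-2}{k-2}+\left\lceil\frac{(k-1)^h-2a_1}{k}\right\rceil.$$
   Context: All graphs are simple, finite and connected, and valency $k>2$ is assumed throughout. For a $k$-regular graph of girth $g$, the signature of a vertex $v$ is the sequence $(a_1,\ldots,a_k)$, listed in non-decreasing order, of the numbers of $g$-cycles containing each of the $k$ edges incident with $v$; the graph is girth-regular if all vertices have the same signature, which is then called the signature of the graph. -}

module Defs where

open import Data.Bool using (Bool; true; false; _∧_; not; T)
open import Data.Nat using (ℕ; zero; suc; _≤ᵇ_)
open import Data.Fin using (Fin)
open import Data.Fin.Properties using (_≟_)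
open import Data.List using (List; []; _∷_; map; concatMap; allFin; filterᵇ; length)
open import Data.Bool.ListAction using (any)
open import Data.Vec using (Vec; []; _∷_; last; toList)
open import Data.Integer using (ℤ)
open import Data.Rational using (ℚ; 0ℚ; _/_)
open import Relation.Nullary.Decidable using (isYes)
open import Relation.Binary.PropositionalEquality using (_≡_)
open import Relation.Binary.Construct.Closure.ReflexiveTransitive using (Star)
open import Data.List.Relation.Binary.Permutation.Propositional using (_↭_)
open import Data.Product using (∃; _×_)
open import Relation.Nullary using (¬_)

record Graph (n : ℕ) : Set where
  field
    adj        : Fin n → Fin n → Bool
    adj-sym    : ∀ u v → adj u v ≡ adj v u
    adj-irrefl : ∀ u → adj u u ≡ false

module _ {n : ℕ} (G : Graph n) where
  open Graph G

  Adj : Fin n → Fin n → Set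
  Adj u v = T (adj u v)

  Connected : Set
  Connected = ∀ u v → Star Adj u v

  neighbours : Fin n → List (Fin n)
  neighbours v = filterᵇ (adj v) (allFin n)

  Regular : ℕ → Set
  Regular k = ∀ v → length (neighbours v) ≡ k

  consecAdj : ∀ {m} → Vec (Fin n) m → Bool
  consecAdj (x ∷ y ∷ r) = adj x y ∧ consecAdj (y ∷ r)
  consecAdj _ = true

  closes : ∀ {m} → Vec (Fin n) m → Bool
  closes [] = false
  closes (x ∷ r) = adj (last (x ∷ r)) x

  distinct : ∀ {m} → Vec (Fin n) m → Bool
  distinct [] = true
  distinct (x ∷ r) = not (any (λ y → isYes (x ≟ y)) (toList r)) ∧ distinct r

  isCycle : ∀ {m} → Vec (Fin n) m → Bool
  isCycle {m} c = (3 ≤ᵇ m) ∧ distinct c ∧ consecAdj c ∧ closes c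

  HasCycleOfLength : ℕ → Set
  HasCycleOfLength m = ∃ λ (c : Vec (Fin n) m) → T (isCycle c)

  IsGirth : ℕ → Set
  IsGirth g = HasCycleOfLength g × (∀ m → m Data.Nat.< g → ¬ HasCycleOfLength m)

  startsWith : ∀ {m} → Fin n → Fin n → Vec (Fin n) m → Bool
  startsWith u w (x ∷ y ∷ _) = isYes (x ≟ u) ∧ isYes (y ≟ w)
  startsWith u w _ = false

  allVecs : ∀ m → List (Vec (Fin n) m)
  allVecs zero = [] ∷ []
  allVecs (suc m) = concatMap (λ x → map (x ∷_) (allVecs m)) (allFin n)

  -- number of g-cycles (as subgraphs) containing edge uw: each such cycle
  -- corresponds to exactly one vertex sequence starting u, w
  cyclesThrough : ℕ → Fin n → Fin n → ℕ
  cyclesThrough g u w =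
    length (filterᵇ (λ c → isCycle c ∧ startsWith u w c) (allVecs g))

  edgeCounts : ℕ → Fin n → List ℕ
  edgeCounts g v = map (cyclesThrough g v) (neighbours v)

  GirthRegular : ∀ {k} → ℕ → Vec ℕ k → Set
  GirthRegular g a =
    IsGirth g
    × Linked Data.Nat._≤_ (toList a)
    × (∀ v → edgeCounts g v ↭ toList a)
    where open import Data.List.Relation.Unary.Linked using (Linked)

-- first entry a₁ of a signature (0 for the empty vector, never used as k ≥ 3)
first : ∀ {k} → Vec ℕ k → ℕ
first [] = 0
first (x ∷ _) = x

-- division of an integer by a natural number, as a rational
-- (value 0 on division by 0; only used with positive denominators)
_÷ℕ_ : ℤ → ℕ → ℚ
p ÷ℕ zero = 0ℚ
p ÷ℕ suc d = p / suc d

-- Fix an edge uv lying on a₁ girth cycles, put q = k - 1 and d = h - 1. Non-backtracking walks of length at most d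
-- leaving u away from v, or leaving v away from u, end at pairwise distinct vertices, since two of them with a common
-- end would close a cycle shorter than 2h. These 2(1 + q + ... + q^d) tree vertices are the sources of k times as many
-- arcs. Each of the q^h one-step extensions of a u-side walk of length d either leaves the tree, giving an arc from a
-- non-tree vertex back into the tree, or ends at the end of a v-side walk of length d and so closes a 2h-cycle through
-- uv; both assignments are injective. Hence 2Sk + q^h ≤ nk + a₁ with S = 1 + q + ... + q^d, and q^h = (q - 1)S + 1
-- turns this into the stated (slightly weaker) bound.
module Submission where

open import Data.Bool using (true; T; T?; _∧_)
open import Data.Bool.ListAction using (any)
open import Data.Bool.Properties using (T-∧; T-not-≡; T-≡; ¬-not)
open import Data.Empty using (⊥; ⊥-elim)
open import Data.Fin using (Fin)
open import Data.Fin.Properties using (_≟_)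
import Data.Integer
open import Data.Integer as ℤ using (ℤ; +_; +≤+; _-_)
open import Data.Integer.DivMod using (div-pos-is-/ℕ; n<s[n/ℕd]*d)
import Data.Integer.Properties as ℤP
open import Data.Integer.Tactic.RingSolver renaming (solve-∀ to ℤ-solve-∀)
open import Data.List
  using (List; []; _∷_; _++_; _∷ʳ_; _ʳ++_; length; map; concatMap; reverse; head; last; allFin; filter; filterᵇ; drop)
open import Data.List.Membership.Propositional using (_∈_; _∉_; find; lose)
open import Data.List.Membership.Propositional.Properties
  using (∈-++⁺ˡ; ∈-++⁺ʳ; ∈-++⁻; ∈-∃++; ∈-concatMap⁺; ∈-concatMap⁻; ∈-map⁺; ∈-map⁻;
         ∈-filter⁺; ∈-filter⁻; ∈-allFin)
open import Data.List.Properties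
  using (length-tabulate; length-reverse; unfold-reverse; reverse-injective; ∷-injective; ∷-injectiveˡ; ∷-injectiveʳ; ≡-dec;
         length-map; filter-reject; filter-all; filter-accept; length-++; ++-assoc; length-ʳ++; ʳ++-defn)
open import Data.List.Relation.Binary.Disjoint.Propositional using (Disjoint)
open import Data.List.Relation.Binary.Permutation.Propositional using (_↭_; ↭-sym; ↭-trans; prep; ↭⇒↭ₛ)
open import Data.List.Relation.Binary.Permutation.Propositional.Properties using (shift; ++⁺ˡ; ↭-reverse; ∈-resp-↭)
open import Data.List.Relation.Binary.Subset.Propositional using (_⊆_)
open import Data.List.Relation.Unary.All as All using ([])
import Data.List.Relation.Unary.All.Properties as All
open import Data.List.Relation.Unary.All.Properties using (¬Any⇒All¬)
open import Data.List.Relation.Unary.Any using (here; there)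
open import Data.List.Relation.Unary.Any.Properties using (any⁻; reverse⁺)
open import Data.List.Relation.Unary.Linked as Linked using (Linked; []; [-]; _∷_)
import Data.List.Relation.Unary.Linked.Properties as Linked
open import Data.List.Relation.Unary.Unique.Propositional using (Unique; []; _∷_)
open import Data.List.Relation.Unary.Unique.Propositional.Properties using (++⁺; map⁺; filter⁺; allFin⁺)
open import Data.Maybe using (just)
open import Data.Maybe.Relation.Binary.Connected as Maybe using (just)
open import Data.Nat using (ℕ; zero; suc; _+_; _*_; _^_; _∸_; _≤_; _<_; z≤n; s≤s; s≤s⁻¹)
open import Data.Nat.Properties
  using (≤-refl; ≤-trans; ≤-reflexive; <-irrefl; <-≤-trans; ≤-<-trans; ≤ᵇ⇒≤; ≤⇒≤ᵇ; 1+n≰n; m≤n⇒m<n∨m≡n; n≤1+n;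
         m≤n⇒m≤1+n; m≤m+n; suc-injective; +-suc; +-comm; +-identityʳ; +-mono-≤; +-monoʳ-≤; +-monoʳ-<; *-comm; *-zeroʳ;
         module ≤-Reasoning)
open import Data.Nat.Tactic.RingSolver using (solve-∀)
open import Data.Product using (_×_; _,_; ∃; ∃₂; proj₁; proj₂; uncurry)
open import Data.Product.Properties using (,-injective; ,-injectiveʳ)
open import Data.Rational using (ceiling) renaming (_≤_ to _≤ℚ_; _+_ to _+ℚ_)
import Data.Rational as ℚ
open ℚ using (mkℚ; ↥_; ↧_)
import Data.Rational.Properties as ℚP
import Data.Rational.Unnormalised as ℚᵘ
import Data.Rational.Unnormalised.Properties as ℚᵘP
open import Data.Sum using (_⊎_; inj₁; inj₂)
open import Data.Sum.Properties using (inj₁-injective; inj₂-injective)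
open import Data.Unit using (⊤; tt)
open import Data.Vec as Vec using (Vec; []; _∷_; toList)
open import Defs
open import Function using (_∘_; id; Equivalence)
open import Relation.Binary.Core using (Rel)
open import Relation.Binary.Definitions using (Symmetric; DecidableEquality)
import Relation.Binary.PropositionalEquality as ≡
open ≡ using (_≡_; _≢_; refl; sym; trans; cong; cong₂; subst; subst₂; module ≡-Reasoning)
open import Relation.Nullary using (¬_; yes; no; ¬?)
open import Relation.Nullary.Decidable using (isYes; toWitness; fromWitness)

module _ {A : Set} where

  lastOr : A → List A → A
  lastOr x []       = x
  lastOr _ (y ∷ ys) = lastOr y ys

  -- Second-to-last element of x ∷ xs (x itself on the junk input xs = []).
  penultimateOr : A → List A → A
  penultimateOr x []           = x
  penultimateOr x (_ ∷ [])     = x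
  penultimateOr _ (y ∷ z ∷ zs) = penultimateOr y (z ∷ zs)

  lastOr-++ : ∀ x xs y ys → lastOr x (xs ++ y ∷ ys) ≡ lastOr y ys
  lastOr-++ x []       y ys = refl
  lastOr-++ x (z ∷ xs) y ys = lastOr-++ z xs y ys

  lastOr-∈ : ∀ x xs → lastOr x xs ∈ x ∷ xs
  lastOr-∈ x []       = here refl
  lastOr-∈ x (y ∷ ys) = there (lastOr-∈ y ys)

  length-<-++∷ : ∀ (xs : List A) y ys → length xs < length (xs ++ y ∷ ys)
  length-<-++∷ []       y ys = s≤s z≤n
  length-<-++∷ (x ∷ xs) y ys = s≤s (length-<-++∷ xs y ys)

  last-∷ : ∀ x xs → last (x ∷ xs) ≡ just (lastOr x xs)
  last-∷ x []       = refl
  last-∷ x (y ∷ ys) = last-∷ y ys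

  head-ʳ++ : ∀ x xs ys → head (xs ʳ++ x ∷ ys) ≡ just (lastOr x xs)
  head-ʳ++ x []       ys = refl
  head-ʳ++ x (y ∷ xs) ys = head-ʳ++ y xs (x ∷ ys)

  NonBacktracking : List A → Set
  NonBacktracking (x ∷ y ∷ z ∷ zs) = x ≢ z × NonBacktracking (y ∷ z ∷ zs)
  NonBacktracking _                = ⊤

  NonBacktracking-tail : ∀ x xs → NonBacktracking (x ∷ xs) → NonBacktracking xs
  NonBacktracking-tail x []           _       = tt
  NonBacktracking-tail x (y ∷ [])     _       = tt
  NonBacktracking-tail x (y ∷ z ∷ zs) (_ , p) = p

  NonBacktracking-++⁻ˡ : ∀ xs {ys} → NonBacktracking (xs ++ ys) → NonBacktracking xs
  NonBacktracking-++⁻ˡ []               _       = tt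
  NonBacktracking-++⁻ˡ (x ∷ [])         _       = tt
  NonBacktracking-++⁻ˡ (x ∷ y ∷ [])     _       = tt
  NonBacktracking-++⁻ˡ (x ∷ y ∷ z ∷ zs) (x≢z , p) = x≢z , NonBacktracking-++⁻ˡ (y ∷ z ∷ zs) p

  NonBacktracking-ʳ++ : ∀ {x y} xs {ys} → NonBacktracking (x ∷ y ∷ xs) → NonBacktracking (y ∷ x ∷ ys)
                      → NonBacktracking (xs ʳ++ y ∷ x ∷ ys)
  NonBacktracking-ʳ++ []       _         q = q
  NonBacktracking-ʳ++ (z ∷ xs) (x≢z , p) q = NonBacktracking-ʳ++ xs p ((λ z≡x → x≢z (sym z≡x)) , q)

  module _ {ℓ} {R : Rel A ℓ} where

    Linked-++⁻ˡ : ∀ xs {ys} → Linked R (xs ++ ys) → Linked R xs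
    Linked-++⁻ˡ []           _         = []
    Linked-++⁻ˡ (x ∷ [])     _         = [-]
    Linked-++⁻ˡ (x ∷ y ∷ xs) (r ∷ rs) = r ∷ Linked-++⁻ˡ (y ∷ xs) rs

    Linked-ʳ++ : Symmetric R → ∀ {x} xs {ys} → Linked R (x ∷ xs) → Linked R (x ∷ ys) → Linked R (xs ʳ++ x ∷ ys)
    Linked-ʳ++ R-sym []       _        q = q
    Linked-ʳ++ R-sym (y ∷ xs) (r ∷ p) q = Linked-ʳ++ R-sym xs p (R-sym r ∷ q)

  Unique-++⁻ : ∀ xs {ys : List A} → Unique (xs ++ ys) → Unique xs × Disjoint xs ys
  Unique-++⁻ []       u        = [] , λ { (() , _) }
  Unique-++⁻ (x ∷ xs) (x∉ ∷ u) with Unique-++⁻ xs u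
  ... | uxs , disjoint = All.++⁻ˡ xs x∉ ∷ uxs , λ where
    (here refl , x∈ys) → All.lookup (All.++⁻ʳ xs x∉) x∈ys refl
    (there v∈xs , v∈ys) → disjoint (v∈xs , v∈ys)

  Unique⇒⊆⇒length≤ : ∀ {xs ys : List A} → Unique xs → xs ⊆ ys → length xs ≤ length ys
  Unique⇒⊆⇒length≤ {[]}     _        _  = z≤n
  Unique⇒⊆⇒length≤ {x ∷ xs} (x∉ ∷ u) xs⊆ys with ∈-∃++ (xs⊆ys (here refl))
  ... | ys₁ , ys₂ , refl = begin
    suc (length xs)               ≤⟨ s≤s (Unique⇒⊆⇒length≤ u xs⊆ys₁ys₂) ⟩
    suc (length (ys₁ ++ ys₂))     ≡⟨ cong suc (length-++ ys₁) ⟩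
    suc (length ys₁ + length ys₂) ≡⟨ +-suc (length ys₁) (length ys₂) ⟨
    length ys₁ + length (x ∷ ys₂) ≡⟨ length-++ ys₁ ⟨
    length (ys₁ ++ x ∷ ys₂)       ∎
    where
    open ≤-Reasoning
    xs⊆ys₁ys₂ : xs ⊆ ys₁ ++ ys₂
    xs⊆ys₁ys₂ {y} y∈xs with ∈-++⁻ ys₁ (xs⊆ys (there y∈xs))
    ... | inj₁ y∈ys₁         = ∈-++⁺ˡ y∈ys₁
    ... | inj₂ (here refl)   = ⊥-elim (All.lookup x∉ y∈xs refl)
    ... | inj₂ (there y∈ys₂) = ∈-++⁺ʳ ys₁ y∈ys₂

  ++-injective : ∀ (xs : List A) {xs′ ys ys′} → length xs ≡ length xs′ → xs ++ ys ≡ xs′ ++ ys′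
               → xs ≡ xs′ × ys ≡ ys′
  ++-injective []       {[]}       _   eq = refl , eq
  ++-injective (x ∷ xs) {x′ ∷ xs′} len eq
    with refl , eq′ ← ∷-injective eq
    with refl , refl ← ++-injective xs {xs′} (suc-injective len) eq′ = refl , refl

module _ {A B : Set} where

  map⁺-injectiveOn : ∀ {f : A → B} {xs} → (∀ {x y} → x ∈ xs → y ∈ xs → f x ≡ f y → x ≡ y)
                   → Unique xs → Unique (map f xs)
  map⁺-injectiveOn {f} {[]}     _   []       = []
  map⁺-injectiveOn {f} {x ∷ xs} inj (x∉ ∷ u) =
    All.map⁺ (All.tabulate (λ {y} y∈xs fx≡fy → All.lookup x∉ y∈xs (inj (here refl) (there y∈xs) fx≡fy)))
    ∷ map⁺-injectiveOn (λ x∈ y∈ → inj (there x∈) (there y∈)) u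

  concatMap⁺ : ∀ {f : A → List B} {xs} → (∀ x → Unique (f x))
             → (∀ {x x′ z} → z ∈ f x → z ∈ f x′ → x ≡ x′) → Unique xs → Unique (concatMap f xs)
  concatMap⁺ {f} {[]}     _  _        _        = []
  concatMap⁺ {f} {x ∷ xs} uf separate (x∉ ∷ u) = ++⁺ (uf x) (concatMap⁺ uf separate u) λ where
    (z∈fx , z∈rest) → let x′ , x′∈xs , z∈fx′ = find (∈-concatMap⁻ f z∈rest) in
      All.lookup x∉ x′∈xs (separate z∈fx z∈fx′)

  length-concatMap-const : ∀ {f : A → List B} {c} xs → (∀ {x} → x ∈ xs → length (f x) ≡ c)
                         → length (concatMap f xs) ≡ length xs * c
  length-concatMap-const     []       _    = refl
  length-concatMap-const {f} (x ∷ xs) lenf =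
    trans (length-++ (f x)) (cong₂ _+_ (lenf (here refl)) (length-concatMap-const xs (lenf ∘ there)))

module _ {A : Set} (_≟_ : DecidableEquality A) where

  length-filter-≢ : ∀ {p} {xs : List A} → Unique xs → p ∈ xs
                  → suc (length (filter (λ y → ¬? (p ≟ y)) xs)) ≡ length xs
  length-filter-≢ {p} {p ∷ xs} (p∉ ∷ _) (here refl) =
    cong (suc ∘ length) (trans (filter-reject (λ y → ¬? (p ≟ y)) (λ p≢p → p≢p refl))
                               (filter-all (λ y → ¬? (p ≟ y)) p∉))
  length-filter-≢ {p} {y ∷ xs} (y∉ ∷ u) (there p∈) =
    trans (cong (suc ∘ length) (filter-accept (λ y → ¬? (p ≟ y)) λ p≡y → All.lookup y∉ p∈ (sym p≡y)))
          (cong suc (length-filter-≢ u p∈))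

module _ {A : Set} where

  -- Pads with d, or truncates, to length m; it is only applied to lists of length m.
  toVecOr : A → List A → (m : ℕ) → Vec A m
  toVecOr d []       zero    = []
  toVecOr d []       (suc m) = d ∷ toVecOr d [] m
  toVecOr d (x ∷ xs) zero    = []
  toVecOr d (x ∷ xs) (suc m) = x ∷ toVecOr d xs m

  toList-toVecOr : ∀ d xs {m} → length xs ≡ m → toList (toVecOr d xs m) ≡ xs
  toList-toVecOr d []       refl = refl
  toList-toVecOr d (x ∷ xs) refl = cong (x ∷_) (toList-toVecOr d xs refl)

  last-∷ᵛ : ∀ {m} x (xs : Vec A m) → Vec.last (x ∷ xs) ≡ lastOr x (toList xs)
  last-∷ᵛ x []       = refl
  last-∷ᵛ x (y ∷ ys) = last-∷ᵛ y ys

2+d+d≡2*[1+d] : ∀ d → suc (suc d + d) ≡ 2 * suc d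
2+d+d≡2*[1+d] = solve-∀

geometric : ℕ → ℕ → ℕ
geometric q zero    = 0
geometric q (suc e) = geometric q e + q ^ e

geometric-sum : ∀ q e → q * geometric (suc q) e + 1 ≡ suc q ^ e
geometric-sum q zero    = cong (_+ 1) (*-zeroʳ q)
geometric-sum q (suc e) = begin
  q * (geometric (suc q) e + suc q ^ e) + 1     ≡⟨ regroup q (geometric (suc q) e) (suc q ^ e) ⟩
  (q * geometric (suc q) e + 1) + q * suc q ^ e ≡⟨ cong (_+ q * suc q ^ e) (geometric-sum q e) ⟩
  suc q ^ e + q * suc q ^ e                     ∎
  where
  open ≡-Reasoning
  regroup : ∀ q g p → q * (g + p) + 1 ≡ (q * g + 1) + q * p
  regroup = solve-∀

module _ {n : ℕ} (G : Graph n) where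
  open Graph G
  open import Data.List.Membership.DecPropositional (_≟_ {n}) using (_∈?_)
  open import Data.List.Relation.Unary.Unique.DecPropositional (_≟_ {n}) using (unique?)
  open import Data.List.Relation.Binary.Permutation.Setoid.Properties (≡.setoid (Fin n)) using (Unique-resp-↭)

  _~_ : Fin n → Fin n → Set
  _~_ = Adj G

  ~-sym : ∀ {x y} → x ~ y → y ~ x
  ~-sym {x} {y} = subst T (adj-sym x y)

  ~-irrefl : ∀ {x} → ¬ x ~ x
  ~-irrefl {x} = subst T (adj-irrefl x)

  Walk : List (Fin n) → Set
  Walk = Linked _~_

  ∈-neighbours⁻ : ∀ {x y} → y ∈ neighbours G x → x ~ y
  ∈-neighbours⁻ {x} y∈ = proj₂ (∈-filter⁻ (T? ∘ adj x) {xs = allFin n} y∈)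

  ∈-neighbours⁺ : ∀ {x y} → x ~ y → y ∈ neighbours G x
  ∈-neighbours⁺ {x} {y} = ∈-filter⁺ (T? ∘ adj x) (∈-allFin y)

  neighbours-unique : ∀ x → Unique (neighbours G x)
  neighbours-unique x = filter⁺ (T? ∘ adj x) {allFin n} (allFin⁺ n)

  CycleBelow : ℕ → Set
  CycleBelow L = ∃ λ m → m < L × HasCycleOfLength G m

  NoCycleBelow : ℕ → Set
  NoCycleBelow L = ∀ m → m < L → ¬ HasCycleOfLength G m

  distinct-intro : ∀ {m} (c : Vec (Fin n) m) → Unique (toList c) → T (distinct G c)
  distinct-intro []      _        = tt
  distinct-intro (x ∷ c) (x∉ ∷ u) = Equivalence.from T-∧ (Equivalence.from T-not-≡ (¬-not x∉c) , distinct-intro c u)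
    where
    x∉c : any (λ y → isYes (x ≟ y)) (toList c) ≢ true
    x∉c found with find (any⁻ _ (toList c) (Equivalence.from T-≡ found))
    ... | y , y∈c , x≟y = All.lookup x∉ y∈c (toWitness x≟y)

  Walk-∷ʳ⇒consecAdj : ∀ {m} x (c : Vec (Fin n) m) {y} → Walk (x ∷ toList c ∷ʳ y)
                    → T (consecAdj G (x ∷ c)) × lastOr x (toList c) ~ y
  Walk-∷ʳ⇒consecAdj x []      (x~y ∷ _)  = tt , x~y
  Walk-∷ʳ⇒consecAdj x (z ∷ c) (x~z ∷ w) with Walk-∷ʳ⇒consecAdj z c w
  ... | consec , end~y = Equivalence.from T-∧ (x~z , consec) , end~y

  isCycle-intro : ∀ {m} x (c : Vec (Fin n) m) → 2 ≤ m → Unique (x ∷ toList c) → Walk (x ∷ toList c ∷ʳ x)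
                → T (isCycle G (x ∷ c))
  isCycle-intro x c 2≤m u closed with Walk-∷ʳ⇒consecAdj x c closed
  ... | consec , end~x =
    Equivalence.from T-∧ (≤⇒≤ᵇ (s≤s 2≤m) ,
      Equivalence.from T-∧ (distinct-intro (x ∷ c) u ,
        Equivalence.from T-∧ (consec , subst (_~ x) (sym (last-∷ᵛ x c)) end~x)))

  toVecOr-isCycle : ∀ x r → 2 ≤ length r → Unique (x ∷ r) → Walk (x ∷ r ∷ʳ x)
                  → T (isCycle G (toVecOr x (x ∷ r) (suc (length r))))
  toVecOr-isCycle x r 2≤ u closed =
    isCycle-intro x (toVecOr x r (length r)) 2≤ (subst (Unique ∘ (x ∷_)) r≡ u) (subst (λ r → Walk (x ∷ r ∷ʳ x)) r≡ closed)
    where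
    r≡ : r ≡ toList (toVecOr x r (length r))
    r≡ = sym (toList-toVecOr x r refl)

  startsWith-intro : ∀ {m} (c : Vec (Fin n) m) {x y r} → toList c ≡ x ∷ y ∷ r → T (startsWith G x y c)
  startsWith-intro (a ∷ b ∷ c) eq with refl , eq′ ← ∷-injective eq with refl ← ∷-injectiveˡ eq′ =
    Equivalence.from T-∧ (fromWitness {a? = a ≟ a} refl , fromWitness {a? = b ≟ b} refl)

  allVecs-complete : ∀ m (c : Vec (Fin n) m) → c ∈ allVecs G m
  allVecs-complete zero    []      = here refl
  allVecs-complete (suc m) (x ∷ c) = ∈-concatMap⁺ _ (lose (∈-allFin x) (∈-map⁺ (x ∷_) (allVecs-complete m c)))

  closedNonBacktracking⇒2≤length : ∀ x r → Walk (x ∷ r ∷ʳ x) → NonBacktracking (x ∷ r ∷ʳ x) → 2 ≤ length r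
  closedNonBacktracking⇒2≤length x []          (x~x ∷ _) _         = ⊥-elim (~-irrefl x~x)
  closedNonBacktracking⇒2≤length x (y ∷ [])    _         (x≢x , _) = ⊥-elim (x≢x refl)
  closedNonBacktracking⇒2≤length x (y ∷ z ∷ r) _         _         = s≤s (s≤s z≤n)

  CycleBelow-mono : ∀ {L L′} → L ≤ L′ → CycleBelow L → CycleBelow L′
  CycleBelow-mono L≤L′ (m , m<L , cycle) = m , <-≤-trans m<L L≤L′ , cycle

  -- The first vertex that recurs closes a cycle, of length at least 3 because the walk does not backtrack.
  ¬Unique⇒CycleBelow : ∀ xs → Walk xs → NonBacktracking xs → ¬ Unique xs → CycleBelow (length xs)
  ¬Unique⇒CycleBelow []      _ _  ¬u = ⊥-elim (¬u [])
  ¬Unique⇒CycleBelow (x ∷ r) w nb ¬u with unique? r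
  ... | no ¬ur = CycleBelow-mono (n≤1+n _) (¬Unique⇒CycleBelow r (Linked.tail w) (NonBacktracking-tail x r nb) ¬ur)
  ... | yes ur with x ∈? r
  ...   | no x∉r = ⊥-elim (¬u (¬Any⇒All¬ r x∉r ∷ ur))
  ...   | yes x∈r with ∈-∃++ x∈r
  ...     | r₁ , r₂ , refl =
    suc (length r₁) , s≤s (length-<-++∷ r₁ x r₂) , toVecOr x (x ∷ r₁) _ ,
    toVecOr-isCycle x r₁ (closedNonBacktracking⇒2≤length x r₁ walk₁ nb₁) (¬Any⇒All¬ r₁ x∉r₁ ∷ ur₁) walk₁
    where
    split : x ∷ r₁ ++ x ∷ r₂ ≡ (x ∷ r₁ ∷ʳ x) ++ r₂
    split = cong (x ∷_) (sym (++-assoc r₁ (x ∷ []) r₂))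
    walk₁ : Walk (x ∷ r₁ ∷ʳ x)
    walk₁ = Linked-++⁻ˡ (x ∷ r₁ ∷ʳ x) (subst Walk split w)
    nb₁ : NonBacktracking (x ∷ r₁ ∷ʳ x)
    nb₁ = NonBacktracking-++⁻ˡ (x ∷ r₁ ∷ʳ x) (subst NonBacktracking split nb)
    ur₁ : Unique r₁
    ur₁ = proj₁ (Unique-++⁻ r₁ ur)
    x∉r₁ : x ∉ r₁
    x∉r₁ x∈r₁ = proj₂ (Unique-++⁻ r₁ ur) (x∈r₁ , here refl)

  closed⇒CycleBelow : ∀ x y s → Walk (x ∷ y ∷ s) → NonBacktracking (x ∷ y ∷ s) → lastOr y s ≡ x
                    → CycleBelow (length (x ∷ y ∷ s))
  closed⇒CycleBelow x y s w nb closes = ¬Unique⇒CycleBelow (x ∷ y ∷ s) w nb λ where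
    (x∉ ∷ _) → All.lookup x∉ (subst (_∈ y ∷ s) closes (lastOr-∈ y s)) refl

  -- Two distinct non-backtracking walks between the same vertices: after their common prefix,
  -- one followed by the other reversed is a closed non-backtracking walk.
  sameEnds⇒CycleBelow : ∀ x r₁ r₂ → Walk (x ∷ r₁) → NonBacktracking (x ∷ r₁)
                      → Walk (x ∷ r₂) → NonBacktracking (x ∷ r₂)
                      → lastOr x r₁ ≡ lastOr x r₂ → r₁ ≢ r₂ → CycleBelow (suc (length r₁ + length r₂))
  sameEnds⇒CycleBelow x []      []      _ _  _ _  _    r₁≢r₂ = ⊥-elim (r₁≢r₂ refl)
  sameEnds⇒CycleBelow x []      (y ∷ s) _ _  w nb ends _     = closed⇒CycleBelow x y s w nb (sym ends)
  sameEnds⇒CycleBelow x (y ∷ s) []      w nb _ _  ends _     =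
    CycleBelow-mono (≤-reflexive (cong suc (sym (+-identityʳ _)))) (closed⇒CycleBelow x y s w nb ends)
  sameEnds⇒CycleBelow x (y₁ ∷ s₁) (y₂ ∷ s₂) w₁ nb₁ w₂ nb₂ ends r₁≢r₂ with y₁ ≟ y₂
  ... | yes refl =
    CycleBelow-mono (s≤s (m≤n⇒m≤1+n (+-monoʳ-≤ (length s₁) (n≤1+n _))))
      (sameEnds⇒CycleBelow y₁ s₁ s₂ (Linked.tail w₁) (NonBacktracking-tail x _ nb₁) (Linked.tail w₂)
        (NonBacktracking-tail x _ nb₂) ends (r₁≢r₂ ∘ cong (y₁ ∷_)))
  ... | no y₁≢y₂ =
    CycleBelow-mono (≤-reflexive (trans (length-ʳ++ (y₂ ∷ s₂)) (+-comm (length (y₂ ∷ s₂)) (length (x ∷ y₁ ∷ s₁)))))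
      (¬Unique⇒CycleBelow loop (Linked-ʳ++ ~-sym (y₂ ∷ s₂) w₂ w₁)
                               (NonBacktracking-ʳ++ s₂ nb₂ (y₂≢y₁ , nb₁)) ¬unique)
    where
    loop : List (Fin n)
    loop = (y₂ ∷ s₂) ʳ++ x ∷ y₁ ∷ s₁
    y₂≢y₁ : y₂ ≢ y₁
    y₂≢y₁ = y₁≢y₂ ∘ sym
    ¬unique : ¬ Unique loop
    ¬unique u = proj₂ (Unique-++⁻ (reverse (y₂ ∷ s₂)) (subst Unique (ʳ++-defn (y₂ ∷ s₂)) u))
      (reverse⁺ (lastOr-∈ y₂ s₂) , there (subst (_∈ y₁ ∷ s₁) ends (lastOr-∈ y₁ s₁)))

  -- Non-backtracking walks of length e from x that continue a walk arriving at x from p.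
  data Away : Fin n → Fin n → ℕ → List (Fin n) → Set where
    start : ∀ {p} x → Away p x 0 (x ∷ [])
    step  : ∀ {p x y e w} → x ~ y → p ≢ y → Away x y e w → Away p x (suc e) (x ∷ w)

  Away⇒length : ∀ {p x e w} → Away p x e w → length w ≡ suc e
  Away⇒length (start x)    = refl
  Away⇒length (step _ _ a) = cong suc (Away⇒length a)

  Away-∷ : ∀ {p x e w} → Away p x e w → ∃ λ r → w ≡ x ∷ r × length r ≡ e
  Away-∷ (start x)    = [] , refl , refl
  Away-∷ (step _ _ a) = _ , refl , Away⇒length a

  Away⇒Walk : ∀ {p x e w} → Away p x e w → Walk w
  Away⇒Walk (start x)                   = [-]
  Away⇒Walk (step x~y _ a@(start _))    = x~y ∷ Away⇒Walk a
  Away⇒Walk (step x~y _ a@(step _ _ _)) = x~y ∷ Away⇒Walk a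

  Away⇒NonBacktracking : ∀ {p x e w} → Away p x e w → NonBacktracking (p ∷ w)
  Away⇒NonBacktracking (start x)                   = tt
  Away⇒NonBacktracking (step _ p≢y (start _))      = p≢y , tt
  Away⇒NonBacktracking (step _ p≢y a@(step _ _ _)) = p≢y , Away⇒NonBacktracking a

  Away-start-unique : ∀ {p q x y e e′ w} → Away p x e w → Away q y e′ w → x ≡ y
  Away-start-unique a₁ a₂ with _ , refl , _ ← Away-∷ a₁ | _ , eq , _ ← Away-∷ a₂ = ∷-injectiveˡ eq

  Away-not-back : ∀ {p x e s} → ¬ Away p x e (x ∷ p ∷ s)
  Away-not-back (step _ p≢p (start _))    = p≢p refl
  Away-not-back (step _ p≢p (step _ _ _)) = p≢p refl

  Away-∷ʳ : ∀ {p x e t y} → Away p x e t → lastOr p t ~ y → penultimateOr p t ≢ y → Away p x (suc e) (t ∷ʳ y)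
  Away-∷ʳ (start x)                     x~y   p≢y   = step x~y p≢y (start _)
  Away-∷ʳ (step x~z p≢z a@(start _))    end~y pen≢y = step x~z p≢z (Away-∷ʳ a end~y pen≢y)
  Away-∷ʳ (step x~z p≢z a@(step _ _ _)) end~y pen≢y = step x~z p≢z (Away-∷ʳ a end~y pen≢y)

  Away-last~penultimate : ∀ {p x e t} → x ~ p → Away p x e t → lastOr p t ~ penultimateOr p t
  Away-last~penultimate x~p (start x)                   = x~p
  Away-last~penultimate _   (step x~z _ a@(start _))    = Away-last~penultimate (~-sym x~z) a
  Away-last~penultimate _   (step x~z _ a@(step _ _ _)) = Away-last~penultimate (~-sym x~z) a

  Away-prefix : ∀ {p x e w y} → Away p x e w → y ∈ w
              → ∃₂ λ e′ w′ → e′ ≤ e × Away p x e′ w′ × (∀ q → lastOr q w′ ≡ y)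
  Away-prefix (start x)        (here refl) = 0 , x ∷ [] , z≤n , start x , λ _ → refl
  Away-prefix (step _ _ _)     (here refl) = 0 , _ ∷ [] , z≤n , start _ , λ _ → refl
  Away-prefix (step x~z p≢z a) (there y∈w) with Away-prefix a y∈w
  ... | e′ , w′ , e′≤e , a′ , ends = suc e′ , _ ∷ w′ , s≤s e′≤e , step x~z p≢z a′ , λ _ → ends _

  forwardNeighbours : Fin n → Fin n → List (Fin n)
  forwardNeighbours p x = filter (λ y → ¬? (p ≟ y)) (neighbours G x)

  ∈-forwardNeighbours⁻ : ∀ {p x y} → y ∈ forwardNeighbours p x → x ~ y × p ≢ y
  ∈-forwardNeighbours⁻ {p} {x} y∈ with ∈-filter⁻ (λ y → ¬? (p ≟ y)) {xs = neighbours G x} y∈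
  ... | y∈nbrs , p≢y = ∈-neighbours⁻ y∈nbrs , p≢y

  forwardNeighbours-unique : ∀ p x → Unique (forwardNeighbours p x)
  forwardNeighbours-unique p x = filter⁺ (λ y → ¬? (p ≟ y)) (neighbours-unique x)

  awayWalks : Fin n → Fin n → ℕ → List (List (Fin n))
  awayWalks p x zero    = (x ∷ []) ∷ []
  awayWalks p x (suc e) = concatMap (λ y → map (x ∷_) (awayWalks x y e)) (forwardNeighbours p x)

  awayWalks-sound : ∀ {p x e w} → w ∈ awayWalks p x e → Away p x e w
  awayWalks-sound {e = zero}  (here refl) = start _
  awayWalks-sound {p} {x} {suc e} w∈
    with y , y∈ , w∈y ← find (∈-concatMap⁻ (λ y → map (x ∷_) (awayWalks x y e)) {xs = forwardNeighbours p x} w∈)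
    with w′ , w′∈ , refl ← ∈-map⁻ (x ∷_) w∈y
    with x~y , p≢y ← ∈-forwardNeighbours⁻ y∈
    = step x~y p≢y (awayWalks-sound w′∈)

  awayWalks-unique : ∀ p x e → Unique (awayWalks p x e)
  awayWalks-unique p x zero    = [] ∷ []
  awayWalks-unique p x (suc e) =
    concatMap⁺ (λ y → map⁺ ∷-injectiveʳ (awayWalks-unique x y e)) separate (forwardNeighbours-unique p x)
    where
    separate : ∀ {y y′ z} → z ∈ map (x ∷_) (awayWalks x y e) → z ∈ map (x ∷_) (awayWalks x y′ e) → y ≡ y′
    separate {y} {y′} z∈ z∈′
      with w , w∈ , refl ← ∈-map⁻ (x ∷_) z∈ | w′ , w′∈ , x∷w≡x∷w′ ← ∈-map⁻ (x ∷_) z∈′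
      with r , refl , _ ← Away-∷ (awayWalks-sound {x} {y} {e} w∈)
         | r′ , refl , _ ← Away-∷ (awayWalks-sound {x} {y′} {e} w′∈)
      = ∷-injectiveˡ (∷-injectiveʳ x∷w≡x∷w′)

  awayWalksBelow : Fin n → Fin n → ℕ → List (List (Fin n))
  awayWalksBelow p x zero    = []
  awayWalksBelow p x (suc e) = awayWalksBelow p x e ++ awayWalks p x e

  awayWalksBelow-sound : ∀ p x e {w} → w ∈ awayWalksBelow p x e → ∃ λ e′ → e′ < e × Away p x e′ w
  awayWalksBelow-sound p x (suc e) w∈ with ∈-++⁻ (awayWalksBelow p x e) w∈
  ... | inj₁ w∈below = let e′ , e′<e , a = awayWalksBelow-sound p x e w∈below in e′ , m≤n⇒m≤1+n e′<e , a
  ... | inj₂ w∈walks = e , ≤-refl , awayWalks-sound w∈walks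

  awayWalksBelow-unique : ∀ p x e → Unique (awayWalksBelow p x e)
  awayWalksBelow-unique p x zero    = []
  awayWalksBelow-unique p x (suc e) =
    ++⁺ (awayWalksBelow-unique p x e) (awayWalks-unique p x e) λ where
      (w∈below , w∈walks) → let e′ , e′<e , a = awayWalksBelow-sound p x e w∈below
                                a′ = awayWalks-sound {p} {x} {e} w∈walks in
        <-irrefl (suc-injective (trans (sym (Away⇒length a)) (Away⇒length a′))) e′<e

  arcsFrom : List (Fin n) → List (Fin n × Fin n)
  arcsFrom = concatMap (λ x → map (x ,_) (neighbours G x))

  ∈-arcsFrom⁺ : ∀ {xs x y} → x ∈ xs → x ~ y → (x , y) ∈ arcsFrom xs
  ∈-arcsFrom⁺ x∈ x~y = ∈-concatMap⁺ _ (lose x∈ (∈-map⁺ _ (∈-neighbours⁺ x~y)))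

  ∈-arcsFrom⁻ : ∀ {xs x y} → (x , y) ∈ arcsFrom xs → x ∈ xs × x ~ y
  ∈-arcsFrom⁻ {xs} xy∈ with x′ , x′∈ , xy∈′ ← find (∈-concatMap⁻ _ {xs = xs} xy∈)
    with _ , y∈ , refl ← ∈-map⁻ _ xy∈′ = x′∈ , ∈-neighbours⁻ y∈

  arcsFrom-unique : ∀ {xs} → Unique xs → Unique (arcsFrom xs)
  arcsFrom-unique = concatMap⁺ (λ x → map⁺ ,-injectiveʳ (neighbours-unique x)) sameSource
    where
    sameSource : ∀ {x x′ z} → z ∈ map (x ,_) (neighbours G x) → z ∈ map (x′ ,_) (neighbours G x′) → x ≡ x′
    sameSource z∈ z∈′ with _ , _ , refl ← ∈-map⁻ _ z∈ | _ , _ , eq ← ∈-map⁻ _ z∈′ = cong proj₁ eq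

  module Sizes {k : ℕ} (regular : Regular G k) where

    length-forwardNeighbours : ∀ {p x} → x ~ p → length (forwardNeighbours p x) ≡ k ∸ 1
    length-forwardNeighbours {p} {x} x~p =
      cong (_∸ 1) (trans (length-filter-≢ _≟_ (neighbours-unique x) (∈-neighbours⁺ x~p)) (regular x))

    length-awayWalks : ∀ {p x} e → x ~ p → length (awayWalks p x e) ≡ (k ∸ 1) ^ e
    length-awayWalks zero    _   = refl
    length-awayWalks {p} {x} (suc e) x~p =
      trans (length-concatMap-const (forwardNeighbours p x) λ y∈ →
               trans (length-map _ (awayWalks x _ e)) (length-awayWalks e (~-sym (proj₁ (∈-forwardNeighbours⁻ y∈)))))
            (cong (_* (k ∸ 1) ^ e) (length-forwardNeighbours x~p))

    length-awayWalksBelow : ∀ {p x} e → x ~ p → length (awayWalksBelow p x e) ≡ geometric (k ∸ 1) e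
    length-awayWalksBelow zero    _   = refl
    length-awayWalksBelow {p} {x} (suc e) x~p =
      trans (length-++ (awayWalksBelow p x e)) (cong₂ _+_ (length-awayWalksBelow e x~p) (length-awayWalks e x~p))

    length-arcsFrom : ∀ xs → length (arcsFrom xs) ≡ length xs * k
    length-arcsFrom xs = length-concatMap-const xs λ {x} _ → trans (length-map _ (neighbours G x)) (regular x)

  module Tree (u v : Fin n) (u~v : u ~ v) (d : ℕ) (girth : NoCycleBelow (2 * suc d)) where

    -- Only applied to nonempty walks, so the default v is never returned.
    end : List (Fin n) → Fin n
    end = lastOr v

    noShortCycle : ∀ {L} → L ≤ 2 * suc d → ¬ CycleBelow L
    noShortCycle L≤ (m , m<L , cycle) = girth m (<-≤-trans m<L L≤) cycle

    +suc<girth : ∀ {e₁ e₂} → e₁ ≤ d → e₂ ≤ d → e₁ + suc e₂ < 2 * suc d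
    +suc<girth e₁≤d e₂≤d = s≤s (+-mono-≤ e₁≤d (≤-trans (s≤s e₂≤d) (≤-reflexive (sym (+-identityʳ (suc d))))))

    +<girth : ∀ {e₁ e₂} → e₁ ≤ d → e₂ ≤ d → e₁ + e₂ < 2 * suc d
    +<girth {e₁} e₁≤d e₂≤d = ≤-<-trans (+-monoʳ-≤ e₁ (n≤1+n _)) (+suc<girth e₁≤d e₂≤d)

    Away⇒Unique : ∀ {p x e w} → e ≤ d → Away p x e w → Unique w
    Away⇒Unique {p} {w = w} e≤d a with unique? w
    ... | yes u = u
    ... | no ¬u = ⊥-elim (noShortCycle length≤
                    (¬Unique⇒CycleBelow w (Away⇒Walk a) (NonBacktracking-tail p w (Away⇒NonBacktracking a)) ¬u))
      where
      length≤ : length w ≤ 2 * suc d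
      length≤ = ≤-trans (≤-reflexive (Away⇒length a)) (≤-trans (s≤s e≤d) (m≤m+n (suc d) _))

    sameSide-end-injective : ∀ {p x e₁ e₂ w₁ w₂} → Away p x e₁ w₁ → Away p x e₂ w₂ → end w₁ ≡ end w₂
                           → e₁ + e₂ < 2 * suc d → w₁ ≡ w₂
    sameSide-end-injective {p} a₁ a₂ ends bound with r₁ , refl , len₁ ← Away-∷ a₁ | r₂ , refl , len₂ ← Away-∷ a₂
      with ≡-dec _≟_ r₁ r₂
    ... | yes refl = refl
    ... | no r₁≢r₂ = ⊥-elim (noShortCycle (subst₂ (λ l₁ l₂ → suc (l₁ + l₂) ≤ 2 * suc d) (sym len₁) (sym len₂) bound)
          (sameEnds⇒CycleBelow _ r₁ r₂ (Away⇒Walk a₁) (NonBacktracking-tail p _ (Away⇒NonBacktracking a₁))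
                                       (Away⇒Walk a₂) (NonBacktracking-tail p _ (Away⇒NonBacktracking a₂)) ends r₁≢r₂))

    oppositeSides-end-disjoint : ∀ {e₁ e₂ w₁ w₂} → Away v u e₁ w₁ → Away u v e₂ w₂ → end w₁ ≡ end w₂
                               → e₁ + suc e₂ < 2 * suc d → ⊥
    oppositeSides-end-disjoint a₁ a₂ ends bound with r₁ , refl , len₁ ← Away-∷ a₁ | r₂ , refl , len₂ ← Away-∷ a₂ =
      noShortCycle (subst₂ (λ l₁ l₂ → suc (l₁ + suc l₂) ≤ 2 * suc d) (sym len₁) (sym len₂) bound)
        (sameEnds⇒CycleBelow u r₁ (v ∷ r₂) (Away⇒Walk a₁) (NonBacktracking-tail v _ (Away⇒NonBacktracking a₁))
                                           (u~v ∷ Away⇒Walk a₂) (Away⇒NonBacktracking a₂) ends λ { refl → Away-not-back a₁ })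

    data InTree (t : List (Fin n)) : Set where
      u-side : ∀ {e} → e ≤ d → Away v u e t → InTree t
      v-side : ∀ {e} → e ≤ d → Away u v e t → InTree t

    end-injective : ∀ {t₁ t₂} → InTree t₁ → InTree t₂ → end t₁ ≡ end t₂ → t₁ ≡ t₂
    end-injective (u-side e₁≤d a₁) (u-side e₂≤d a₂) ends = sameSide-end-injective a₁ a₂ ends (+<girth e₁≤d e₂≤d)
    end-injective (v-side e₁≤d a₁) (v-side e₂≤d a₂) ends = sameSide-end-injective a₁ a₂ ends (+<girth e₁≤d e₂≤d)
    end-injective (u-side e₁≤d a₁) (v-side e₂≤d a₂) ends =
      ⊥-elim (oppositeSides-end-disjoint a₁ a₂ ends (+suc<girth e₁≤d e₂≤d))
    end-injective (v-side e₁≤d a₁) (u-side e₂≤d a₂) ends =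
      ⊥-elim (oppositeSides-end-disjoint a₂ a₁ (sym ends) (+suc<girth e₂≤d e₁≤d))

    treeWalks : List (List (Fin n))
    treeWalks = awayWalksBelow v u (suc d) ++ awayWalksBelow u v (suc d)

    treeWalks-sound : ∀ {t} → t ∈ treeWalks → InTree t
    treeWalks-sound t∈ with ∈-++⁻ (awayWalksBelow v u (suc d)) t∈
    ... | inj₁ t∈u = let _ , e<h , a = awayWalksBelow-sound v u (suc d) t∈u in u-side (s≤s⁻¹ e<h) a
    ... | inj₂ t∈v = let _ , e<h , a = awayWalksBelow-sound u v (suc d) t∈v in v-side (s≤s⁻¹ e<h) a

    treeWalks-unique : Unique treeWalks
    treeWalks-unique = ++⁺ (awayWalksBelow-unique v u (suc d)) (awayWalksBelow-unique u v (suc d)) λ where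
      (t∈u , t∈v) → let _ , _ , a₁ = awayWalksBelow-sound v u (suc d) t∈u
                        _ , _ , a₂ = awayWalksBelow-sound u v (suc d) t∈v in
        ~-irrefl (subst (u ~_) (sym (Away-start-unique a₁ a₂)) u~v)

    treeVertices : List (Fin n)
    treeVertices = map end treeWalks

    treeVertices-unique : Unique treeVertices
    treeVertices-unique =
      map⁺-injectiveOn (λ t∈ t′∈ → end-injective (treeWalks-sound t∈) (treeWalks-sound t′∈)) treeWalks-unique

    -- Any other tree walk ending where w ends would close, together with w, a cycle shorter than 2(d + 1).
    hit⇒v-side : ∀ {w t} → Away v u (suc d) w → InTree t → end w ≡ end t → Away u v d t
    hit⇒v-side {w} {t} a (u-side {e} e≤d a′) ends = ⊥-elim (1+n≰n (subst (_≤ d) e≡1+d e≤d))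
      where
      t≡w : t ≡ w
      t≡w = sameSide-end-injective a′ a (sym ends) (+suc<girth e≤d ≤-refl)
      e≡1+d : e ≡ suc d
      e≡1+d = suc-injective (trans (sym (Away⇒length a′)) (trans (cong length t≡w) (Away⇒length a)))
    hit⇒v-side a (v-side e≤d a′) ends with m≤n⇒m<n∨m≡n e≤d
    ... | inj₂ refl = a′
    ... | inj₁ e<d  = ⊥-elim (oppositeSides-end-disjoint a a′ ends
                        (+-monoʳ-< (suc d) (s≤s (≤-trans e<d (≤-reflexive (sym (+-identityʳ d)))))))

    closingCycle : List (Fin n) → List (Fin n) → List (Fin n)
    closingCycle t w = u ∷ w ++ reverse (drop 1 t)

    length-closingCycle : ∀ {t w} → Away v u d t → Away u v d w → length (closingCycle t w) ≡ 2 * suc d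
    length-closingCycle {w = w} at aw with X , refl , lenX ← Away-∷ at = begin
      suc (length (w ++ reverse X))           ≡⟨ cong suc (length-++ w) ⟩
      suc (length w + length (reverse X))     ≡⟨ cong suc (cong₂ _+_ (Away⇒length aw) (trans (length-reverse X) lenX)) ⟩
      suc (suc d + d)                         ≡⟨ 2+d+d≡2*[1+d] d ⟩
      2 * suc d                               ∎
      where open ≡-Reasoning

    closingCycle-unique : ∀ {t w} → Away v u d t → Away u v d w → Unique (closingCycle t w)
    closingCycle-unique {w = w} at aw with X , refl , _ ← Away-∷ at =
      Unique-resp-↭ (↭⇒↭ₛ (↭-sym rotate)) (++⁺ (Away⇒Unique ≤-refl aw) (Away⇒Unique ≤-refl at) disjoint)
      where
      rotate : u ∷ w ++ reverse X ↭ w ++ u ∷ X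
      rotate = ↭-trans (↭-sym (shift u w (reverse X))) (++⁺ˡ w (prep u (↭-reverse X)))
      disjoint : Disjoint w (u ∷ X)
      disjoint (y∈w , y∈t)
        with _ , _ , e₁≤d , a₁ , ends₁ ← Away-prefix aw y∈w | _ , _ , e₂≤d , a₂ , ends₂ ← Away-prefix at y∈t =
        oppositeSides-end-disjoint a₂ a₁ (trans (ends₂ v) (sym (ends₁ v))) (+suc<girth e₂≤d e₁≤d)

    closingCycle-closed : ∀ {t w} → Away v u d t → Away u v d w → end t ~ end w → Walk (closingCycle t w ∷ʳ u)
    closingCycle-closed at aw t~w with X , refl , _ ← Away-∷ at | Y , refl , _ ← Away-∷ aw =
      subst Walk (sym shape) (Linked.++⁺ (u~v ∷ Away⇒Walk aw) connection (Linked-ʳ++ ~-sym X (Away⇒Walk at) [-]))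
      where
      shape : closingCycle (u ∷ X) (v ∷ Y) ∷ʳ u ≡ (u ∷ v ∷ Y) ++ reverse (u ∷ X)
      shape = cong (u ∷_) (trans (++-assoc (v ∷ Y) (reverse X) (u ∷ [])) (cong ((v ∷ Y) ++_) (sym (unfold-reverse u X))))
      connection : Maybe.Connected _~_ (last (u ∷ v ∷ Y)) (head (X ʳ++ u ∷ []))
      connection = subst₂ (Maybe.Connected _~_) (sym (last-∷ u (v ∷ Y))) (sym (head-ʳ++ u X [])) (just (~-sym t~w))

    closingCycle-injective : ∀ {t t′ w w′} → Away v u d t → Away v u d t′ → Away u v d w → Away u v d w′
                           → closingCycle t w ≡ closingCycle t′ w′ → t ≡ t′ × w ≡ w′
    closingCycle-injective {w = w} {w′} at at′ aw aw′ eq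
      with X , refl , _ ← Away-∷ at | X′ , refl , _ ← Away-∷ at′
      with refl , reverses ← ++-injective w {w′} (trans (Away⇒length aw) (sym (Away⇒length aw′))) (∷-injectiveʳ eq) =
      cong (u ∷_) (reverse-injective reverses) , refl

    cycleVector : List (Fin n) → List (Fin n) → Vec (Fin n) (2 * suc d)
    cycleVector t w = toVecOr u (closingCycle t w) (2 * suc d)

    cycleVector-injective : ∀ {t t′ w w′} → Away v u d t → Away v u d t′ → Away u v d w → Away u v d w′
                          → cycleVector t w ≡ cycleVector t′ w′ → t ≡ t′ × w ≡ w′
    cycleVector-injective {t} {t′} {w} {w′} at at′ aw aw′ eq = closingCycle-injective at at′ aw aw′ (begin
      closingCycle t w            ≡⟨ toList-toVecOr u _ (length-closingCycle at aw) ⟨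
      toList (cycleVector t w)    ≡⟨ cong toList eq ⟩
      toList (cycleVector t′ w′)  ≡⟨ toList-toVecOr u _ (length-closingCycle at′ aw′) ⟩
      closingCycle t′ w′          ∎)
      where open ≡-Reasoning

    cyclesThroughUV : List (Vec (Fin n) (2 * suc d))
    cyclesThroughUV = filterᵇ (λ c → isCycle G c ∧ startsWith G u v c) (allVecs G (2 * suc d))

    cycleVector-∈ : ∀ {t w} → 1 ≤ d → Away v u d t → Away u v d w → end t ~ end w → cycleVector t w ∈ cyclesThroughUV
    cycleVector-∈ {t} {w} 1≤d at aw t~w with Y , refl , _ ← Away-∷ aw =
      ∈-filter⁺ (λ c → T? (isCycle G c ∧ startsWith G u v c)) (allVecs-complete _ _) (Equivalence.from T-∧ (cycle , starts))
      where
      rest : List (Fin n)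
      rest = v ∷ Y ++ reverse (drop 1 t)
      length≡ : suc (length rest) ≡ 2 * suc d
      length≡ = length-closingCycle at aw
      cycle : T (isCycle G (cycleVector t (v ∷ Y)))
      cycle = subst (λ m → T (isCycle G (toVecOr u (u ∷ rest) m))) length≡
        (toVecOr-isCycle u rest (subst (2 ≤_) (sym (suc-injective length≡)) (+-mono-≤ 1≤d (s≤s z≤n)))
          (closingCycle-unique at aw) (closingCycle-closed at aw t~w))
      starts : T (startsWith G u v (cycleVector t (v ∷ Y)))
      starts = startsWith-intro (cycleVector t (v ∷ Y)) (toList-toVecOr u (u ∷ rest) length≡)

    frontier : List (List (Fin n) × Fin n)
    frontier = concatMap (λ t → map (t ,_) (forwardNeighbours (penultimateOr v t) (end t))) (awayWalks v u d)

    frontier-sound : ∀ {t y} → (t , y) ∈ frontier → Away v u d t × Away v u (suc d) (t ∷ʳ y) × end t ~ y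
    frontier-sound ty∈
      with t , t∈ , ty∈′ ← find (∈-concatMap⁻ _ {xs = awayWalks v u d} ty∈)
      with y , y∈ , refl ← ∈-map⁻ _ ty∈′
      with t~y , pen≢y ← ∈-forwardNeighbours⁻ y∈
      = awayWalks-sound t∈ , Away-∷ʳ (awayWalks-sound t∈) t~y pen≢y , t~y

    frontier-unique : Unique frontier
    frontier-unique =
      concatMap⁺ (λ t → map⁺ ,-injectiveʳ (forwardNeighbours-unique _ _)) sameWalk (awayWalks-unique v u d)
      where
      sameWalk : ∀ {t t′ z} → z ∈ map (t ,_) (forwardNeighbours (penultimateOr v t) (end t))
               → z ∈ map (t′ ,_) (forwardNeighbours (penultimateOr v t′) (end t′)) → t ≡ t′
      sameWalk z∈ z∈′ with _ , _ , refl ← ∈-map⁻ _ z∈ | _ , _ , eq ← ∈-map⁻ _ z∈′ = cong proj₁ eq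

    hitOrArc : List (Fin n) → Fin n → (Fin n × Fin n) ⊎ Vec (Fin n) (2 * suc d)
    hitOrArc t y with y ∈? treeVertices
    ... | no _   = inj₁ (y , end t)
    ... | yes y∈ = inj₂ (cycleVector t (proj₁ (∈-map⁻ end y∈)))

    hit-closes : ∀ {t y} → (t , y) ∈ frontier → (y∈ : y ∈ treeVertices)
               → let W = proj₁ (∈-map⁻ end y∈) in Away u v d W × end t ~ end W × y ≡ end W
    hit-closes {t} {y} ty∈ y∈ with W , W∈ , y≡ ← ∈-map⁻ end y∈ with at , aty , t~y ← frontier-sound ty∈ =
      hit⇒v-side aty (treeWalks-sound W∈) (trans (lastOr-++ v t y []) y≡) , subst (end t ~_) y≡ t~y , y≡

    hitOrArc-injective : ∀ {a b} → a ∈ frontier → b ∈ frontier → uncurry hitOrArc a ≡ uncurry hitOrArc b → a ≡ b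
    hitOrArc-injective {t , y} {t′ , y′} ty∈ ty′∈ eq with y ∈? treeVertices | y′ ∈? treeVertices
    hitOrArc-injective {t , y} {t′ , y′} ty∈ ty′∈ eq | no _ | no _ with refl , ends ← ,-injective (inj₁-injective eq) =
      cong (_, y) (end-injective (u-side ≤-refl (proj₁ (frontier-sound ty∈)))
                                 (u-side ≤-refl (proj₁ (frontier-sound ty′∈))) ends)
    hitOrArc-injective {t , y} {t′ , y′} ty∈ ty′∈ () | no _ | yes _
    hitOrArc-injective {t , y} {t′ , y′} ty∈ ty′∈ () | yes _ | no _
    hitOrArc-injective {t , y} {t′ , y′} ty∈ ty′∈ eq | yes y∈ | yes y′∈
      with aw , _ , y≡ ← hit-closes ty∈ y∈ | aw′ , _ , y′≡ ← hit-closes ty′∈ y′∈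
      with refl , W≡W′ ← cycleVector-injective (proj₁ (frontier-sound ty∈)) (proj₁ (frontier-sound ty′∈)) aw aw′
                                                (inj₂-injective eq)
      = cong (t ,_) (trans y≡ (trans (cong end W≡W′) (sym y′≡)))

    module ArcCount {k : ℕ} (regular : Regular G k) (1≤d : 1 ≤ d) where
      open Sizes regular

      arcs : List (Fin n × Fin n)
      arcs = arcsFrom (allFin n)

      images : List ((Fin n × Fin n) ⊎ Vec (Fin n) (2 * suc d))
      images = map inj₁ (arcsFrom treeVertices) ++ map (uncurry hitOrArc) frontier

      targets : List ((Fin n × Fin n) ⊎ Vec (Fin n) (2 * suc d))
      targets = map inj₁ arcs ++ map inj₂ cyclesThroughUV

      images-unique : Unique images
      images-unique = ++⁺ (map⁺ inj₁-injective (arcsFrom-unique treeVertices-unique))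
        (map⁺-injectiveOn hitOrArc-injective frontier-unique) λ (z∈arcs , z∈hits) → notTreeArc z∈arcs z∈hits
        where
        notTreeArc : ∀ {z} → z ∈ map inj₁ (arcsFrom treeVertices) → z ∉ map (uncurry hitOrArc) frontier
        notTreeArc z∈arcs z∈hits
          with (x , _) , xz∈ , refl ← ∈-map⁻ inj₁ z∈arcs | (t , y) , ty∈ , eq ← ∈-map⁻ (uncurry hitOrArc) z∈hits
          with y ∈? treeVertices
        ... | no y∉ = y∉ (subst (_∈ treeVertices) (proj₁ (,-injective (inj₁-injective eq)))
                               (proj₁ (∈-arcsFrom⁻ {treeVertices} xz∈)))
        ... | yes _ with () ← eq

      images⊆targets : images ⊆ targets
      images⊆targets z∈ with ∈-++⁻ (map inj₁ (arcsFrom treeVertices)) z∈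
      ... | inj₁ z∈arcs with (x , y) , xy∈ , refl ← ∈-map⁻ inj₁ z∈arcs =
        ∈-++⁺ˡ (∈-map⁺ inj₁ (∈-arcsFrom⁺ (∈-allFin x) (proj₂ (∈-arcsFrom⁻ {treeVertices} xy∈))))
      ... | inj₂ z∈hits with (t , y) , ty∈ , refl ← ∈-map⁻ (uncurry hitOrArc) z∈hits with y ∈? treeVertices
      ...   | no _ = ∈-++⁺ˡ (∈-map⁺ inj₁ (∈-arcsFrom⁺ (∈-allFin y) (~-sym (proj₂ (proj₂ (frontier-sound ty∈))))))
      ...   | yes y∈ with aw , t~W , _ ← hit-closes ty∈ y∈ =
        ∈-++⁺ʳ (map inj₁ arcs) (∈-map⁺ inj₂ (cycleVector-∈ 1≤d (proj₁ (frontier-sound ty∈)) aw t~W))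

      length-images : length images ≡ (geometric (k ∸ 1) (suc d) + geometric (k ∸ 1) (suc d)) * k + (k ∸ 1) ^ suc d
      length-images = begin
        length images
          ≡⟨ length-++ (map inj₁ (arcsFrom treeVertices)) ⟩
        length (map inj₁ (arcsFrom treeVertices)) + length (map (uncurry hitOrArc) frontier)
          ≡⟨ cong₂ _+_ (trans (length-map inj₁ (arcsFrom treeVertices)) (length-arcsFrom treeVertices))
                       (length-map _ frontier) ⟩
        length treeVertices * k + length frontier
          ≡⟨ cong₂ (λ l m → l * k + m) length-treeVertices length-frontier ⟩
        (geometric (k ∸ 1) (suc d) + geometric (k ∸ 1) (suc d)) * k + (k ∸ 1) ^ suc d
          ∎
        where
        open ≡-Reasoning
        length-treeVertices : length treeVertices ≡ geometric (k ∸ 1) (suc d) + geometric (k ∸ 1) (suc d)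
        length-treeVertices = trans (length-map end treeWalks) (trans (length-++ (awayWalksBelow v u (suc d)))
          (cong₂ _+_ (length-awayWalksBelow (suc d) u~v) (length-awayWalksBelow (suc d) (~-sym u~v))))
        length-frontier : length frontier ≡ (k ∸ 1) ^ suc d
        length-frontier = trans
          (length-concatMap-const (awayWalks v u d) λ t∈ → trans (length-map _ (forwardNeighbours _ _))
            (length-forwardNeighbours (Away-last~penultimate u~v (awayWalks-sound {v} {u} {d} t∈))))
          (trans (cong (_* (k ∸ 1)) (length-awayWalks d u~v)) (*-comm ((k ∸ 1) ^ d) (k ∸ 1)))

      length-targets : length targets ≡ n * k + cyclesThrough G (2 * suc d) u v
      length-targets = trans (length-++ (map inj₁ arcs)) (cong₂ _+_
        (trans (length-map inj₁ arcs) (trans (length-arcsFrom (allFin n)) (cong (_* k) (length-tabulate {n = n} id))))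
        (length-map inj₂ cyclesThroughUV))

      count : (geometric (k ∸ 1) (suc d) + geometric (k ∸ 1) (suc d)) * k + (k ∸ 1) ^ suc d
            ≤ n * k + cyclesThrough G (2 * suc d) u v
      count = subst₂ _≤_ length-images length-targets (Unique⇒⊆⇒length≤ images-unique images⊆targets)

  cycle-length≥3 : ∀ {m} → HasCycleOfLength G m → 3 ≤ m
  cycle-length≥3 {m} (c , c-cycle) = ≤ᵇ⇒≤ 3 m (proj₁ (Equivalence.to T-∧ c-cycle))

  edge-count : ∀ {k h u v} → Regular G k → IsGirth G (2 * h) → u ~ v
             → (geometric (k ∸ 1) h + geometric (k ∸ 1) h) * k + (k ∸ 1) ^ h ≤ n * k + cyclesThrough G (2 * h) u v
  edge-count {h = zero}                _       (cycle , _) _   with () ← cycle-length≥3 cycle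
  edge-count {h = suc zero}            _       (cycle , _) _   with s≤s (s≤s ()) ← cycle-length≥3 cycle
  edge-count {h = suc (suc d)} {u} {v} regular (_ , girth) u~v =
    Tree.ArcCount.count u v u~v (suc d) girth regular (s≤s z≤n)

  cycle-vertex : ∀ {m} → HasCycleOfLength G m → Fin n
  cycle-vertex {suc m} (x ∷ _ , _) = x

  signature-edge : ∀ {g k} {a : Vec ℕ (suc k)} → (∀ x → edgeCounts G g x ↭ toList a)
                 → ∀ u → ∃ λ v → u ~ v × first a ≡ cyclesThrough G g u v
  signature-edge {g} {a = a₁ ∷ _} signature u
    with v , v∈ , a₁≡ ← ∈-map⁻ (cyclesThrough G g u) (∈-resp-↭ (↭-sym (signature u)) (here refl)) =
    v , ∈-neighbours⁻ v∈ , a₁≡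

floor-greatest : ∀ p (m : ℤ) → m ℤ.* ↧ p ℤ.≤ ↥ p → m ℤ.≤ ℚ.floor p
floor-greatest (mkℚ N d _) m m*d≤N with m ℤ.≤? N ℤ./ℕ suc d
... | yes m≤N/d = subst (m ℤ.≤_) (sym (div-pos-is-/ℕ N (suc d))) m≤N/d
... | no  m≰N/d = ⊥-elim (ℤP.<-irrefl refl (ℤP.<-≤-trans (n<s[n/ℕd]*d N (suc d))
                    (ℤP.≤-trans (ℤP.*-monoʳ-≤-nonNeg (+ suc d) (ℤP.i<j⇒suc[i]≤j (ℤP.≰⇒> m≰N/d))) m*d≤N)))

ceiling-least : ∀ p (z : ℤ) → ↥ p ℤ.≤ z ℤ.* ↧ p → ℚ.ceiling p ℤ.≤ z
ceiling-least p@(mkℚ _ _ _) z ↥p≤z*↧p =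
  subst (ℚ.ceiling p ℤ.≤_) (ℤP.neg-involutive z) (ℤP.neg-mono-≤ (floor-greatest (ℚ.- p) (ℤ.- z) negated))
  where
  negated : ℤ.- z ℤ.* ↧ (ℚ.- p) ℤ.≤ ↥ (ℚ.- p)
  negated = subst₂ ℤ._≤_ (trans (ℤP.neg-distribˡ-* z (↧ p)) (cong (ℤ.- z ℤ.*_) (sym (ℚP.↧-neg p))))
                         (sym (ℚP.↥-neg p)) (ℤP.neg-mono-≤ ↥p≤z*↧p)

/-≤ᵘ : ∀ x z d → x ℤ.≤ z ℤ.* + suc d → ℚ.toℚᵘ (x ℚ./ suc d) ℚᵘ.≤ ℚᵘ.mkℚᵘ z 0
/-≤ᵘ x z d x≤z*d = ℚᵘP.≤-respˡ-≃ (ℚᵘP.≃-sym (ℚP.toℚᵘ-fromℚᵘ (ℚᵘ.mkℚᵘ x d)))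
                                  (ℚᵘ.*≤* (subst (ℤ._≤ z ℤ.* + suc d) (sym (ℤP.*-identityʳ x)) x≤z*d))

ceiling-/-least : ∀ x z d → x ℤ.≤ z ℤ.* + suc d → ℚ.ceiling (x ℚ./ suc d) ℤ.≤ z
ceiling-/-least x z d x≤z*d with ℚᵘ.*≤* ↥≤ ← /-≤ᵘ x z d x≤z*d = ceiling-least p z
  (subst₂ ℤ._≤_ (trans (cong (ℤ._* + 1) (ℚP.↥ᵘ-toℚᵘ p)) (ℤP.*-identityʳ (↥ p)))
                (cong (z ℤ.*_) (ℚP.↧ᵘ-toℚᵘ p)) ↥≤)
  where
  p : ℚ.ℚ
  p = x ℚ./ suc d

mkℚᵘ-+ : ∀ i j → ℚᵘ.mkℚᵘ i 0 ℚᵘ.+ ℚᵘ.mkℚᵘ j 0 ℚᵘ.≃ ℚᵘ.mkℚᵘ (i ℤ.+ j) 0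
mkℚᵘ-+ i j = ℚᵘ.*≡* (sum i j)
  where
  sum : ∀ i j → (i ℤ.* + 1 ℤ.+ j ℤ.* + 1) ℤ.* + 1 ≡ (i ℤ.+ j) ℤ.* + 1
  sum = ℤ-solve-∀

pos-*-+ : ∀ x y z → + (x * y + z) ≡ + x ℤ.* + y ℤ.+ + z
pos-*-+ x y z = trans (ℤP.pos-+ (x * y) z) (cong (ℤ._+ + z) (ℤP.pos-* x y))

tree-term-≤ : ∀ K S → + 2 ℤ.* (+ (suc K * S + 1) ℤ.- + 2) ℤ.≤ + (S + S) ℤ.* + suc K
tree-term-≤ K S = begin
  + 2 ℤ.* (+ (suc K * S + 1) ℤ.- + 2)                      ≡⟨ cong (λ i → + 2 ℤ.* (i ℤ.- + 2)) (pos-*-+ (suc K) S 1) ⟩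
  + 2 ℤ.* (+ suc K ℤ.* + S ℤ.+ + 1 ℤ.- + 2)                ≤⟨ ℤP.i≤i+j _ (+ 2) ⟩
  + 2 ℤ.* (+ suc K ℤ.* + S ℤ.+ + 1 ℤ.- + 2) ℤ.+ + 2        ≡⟨ identity (+ suc K) (+ S) ⟩
  (+ S ℤ.+ + S) ℤ.* + suc K                                ≡⟨ cong (ℤ._* + suc K) (ℤP.pos-+ S S) ⟨
  + (S + S) ℤ.* + suc K                                    ∎
  where
  open ℤP.≤-Reasoning
  identity : ∀ K S → + 2 ℤ.* ((K ℤ.* S ℤ.+ + 1) ℤ.- + 2) ℤ.+ + 2 ≡ (S ℤ.+ S) ℤ.* K
  identity = ℤ-solve-∀

frontier-term-≤ : ∀ n k s Q a → s * k + Q ≤ n * k + a → + Q ℤ.- + (2 * a) ℤ.≤ (+ n ℤ.- + s) ℤ.* + k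
frontier-term-≤ n k s Q a count = begin
  + Q ℤ.- + (2 * a)                             ≤⟨ ℤP.+-monoʳ-≤ (+ Q) (ℤP.neg-mono-≤ (+≤+ (m≤m+n a (a + 0)))) ⟩
  + Q ℤ.- + a                                   ≡⟨ shift₁ (+ Q) (+ a) (+ s) (+ k) ⟩
  (+ s ℤ.* + k ℤ.+ + Q ℤ.- + a) ℤ.- + s ℤ.* + k ≡⟨ cong (λ i → i ℤ.- + a ℤ.- + s ℤ.* + k) (pos-*-+ s k Q) ⟨
  (+ (s * k + Q) ℤ.- + a) ℤ.- + s ℤ.* + k       ≤⟨ ℤP.+-monoˡ-≤ (ℤ.- (+ s ℤ.* + k)) (ℤP.+-monoˡ-≤ (ℤ.- + a) (+≤+ count)) ⟩
  (+ (n * k + a) ℤ.- + a) ℤ.- + s ℤ.* + k       ≡⟨ cong (λ i → i ℤ.- + a ℤ.- + s ℤ.* + k) (pos-*-+ n k a) ⟩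
  (+ n ℤ.* + k ℤ.+ + a ℤ.- + a) ℤ.- + s ℤ.* + k ≡⟨ shift₂ (+ n) (+ a) (+ s) (+ k) ⟩
  (+ n ℤ.- + s) ℤ.* + k                         ∎
  where
  open ℤP.≤-Reasoning
  shift₁ : ∀ Q a s k → Q ℤ.- a ≡ (s ℤ.* k ℤ.+ Q ℤ.- a) ℤ.- s ℤ.* k
  shift₁ = ℤ-solve-∀
  shift₂ : ∀ n a s k → (n ℤ.* k ℤ.+ a ℤ.- a) ℤ.- s ℤ.* k ≡ (n ℤ.- s) ℤ.* k
  shift₂ = ℤ-solve-∀

count⇒bound : ∀ n k′ S Q a → suc k′ * S + 1 ≡ Q → (S + S) * (3 + k′) + Q ≤ n * (3 + k′) + a
            → (+ 2 ℤ.* (+ Q ℤ.- + 2)) ÷ℕ (suc k′) ℚ.+ (ℚ.ceiling ((+ Q ℤ.- + (2 * a)) ÷ℕ (3 + k′)) ÷ℕ 1)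
              ℚ.≤ ((+ n) ÷ℕ 1)
count⇒bound n k′ S Q a refl count = ℚP.toℚᵘ-cancel-≤ (begin
  ℚ.toℚᵘ (x ℚ./ suc k′ ℚ.+ c ℚ./ 1)              ≃⟨ ℚP.toℚᵘ-homo-+ (x ℚ./ suc k′) (c ℚ./ 1) ⟩
  ℚ.toℚᵘ (x ℚ./ suc k′) ℚᵘ.+ ℚ.toℚᵘ (c ℚ./ 1)    ≤⟨ ℚᵘP.+-mono-≤ (/-≤ᵘ x (+ s) k′ (tree-term-≤ k′ S))
                                                                  (/-≤ᵘ c (+ n ℤ.- + s) 0 c≤) ⟩
  ℚᵘ.mkℚᵘ (+ s) 0 ℚᵘ.+ ℚᵘ.mkℚᵘ (+ n ℤ.- + s) 0   ≃⟨ mkℚᵘ-+ (+ s) (+ n ℤ.- + s) ⟩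
  ℚᵘ.mkℚᵘ (+ s ℤ.+ (+ n ℤ.- + s)) 0              ≡⟨ cong (λ i → ℚᵘ.mkℚᵘ i 0) (cancel (+ s) (+ n)) ⟩
  ℚᵘ.mkℚᵘ (+ n) 0                                ≃⟨ ℚᵘP.≃-sym (ℚP.toℚᵘ-fromℚᵘ (ℚᵘ.mkℚᵘ (+ n) 0)) ⟩
  ℚ.toℚᵘ (+ n ℚ./ 1)                             ∎)
  where
  open ℚᵘP.≤-Reasoning
  s : ℕ
  s = S + S
  x c : ℤ
  x = + 2 ℤ.* (+ (suc k′ * S + 1) ℤ.- + 2)
  c = ℚ.ceiling ((+ (suc k′ * S + 1) ℤ.- + (2 * a)) ℚ./ (3 + k′))
  c≤ : c ℤ.≤ (+ n ℤ.- + s) ℤ.* + 1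
  c≤ = subst (c ℤ.≤_) (sym (ℤP.*-identityʳ (+ n ℤ.- + s)))
         (ceiling-/-least _ (+ n ℤ.- + s) (2 + k′) (frontier-term-≤ n (3 + k′) s (suc k′ * S + 1) a count))
  cancel : ∀ s n → s ℤ.+ (n ℤ.- s) ≡ n
  cancel = ℤ-solve-∀

theorem4p1 : (n k g h : ℕ) → 3 ≤ k → (G : Graph n) → Connected G → Regular G k
    → g ≡ 2 * h → (a : Vec ℕ k) → GirthRegular G g a
    → (+ 2 Data.Integer.* (+ ((k ∸ 1) ^ h) - + 2)) ÷ℕ (k ∸ 2)
        +ℚ ((ceiling ((+ ((k ∸ 1) ^ h) - + (2 * first a)) ÷ℕ k)) ÷ℕ 1)
      ≤ℚ ((+ n) ÷ℕ 1)
theorem4p1 n (suc (suc (suc k′))) g h (s≤s (s≤s (s≤s z≤n))) G _ regular refl a (girth , _ , signature)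
  with v , u~v , a₁≡ ← signature-edge G {2 * h} signature (cycle-vertex G (proj₁ girth)) =
  count⇒bound n k′ (geometric (2 + k′) h) ((2 + k′) ^ h) (first a) (geometric-sum (suc k′) h)
    (subst (λ c → _ ≤ n * (3 + k′) + c) (sym a₁≡) (edge-count G {h = h} regular girth u~v))
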